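{- For every positive integer $n$ with $n \equiv 0 \pmod 4$ or $n \equiv 1 \pmod 4$, the transitive tournament $TT_n$ admits a chain--collider--fork decomposition consisting of exactly $\left\lfloor \frac{n-1}{2}\right\rfloor$ chains, $\left\lfloor \frac{n}{4}\right\rfloor$ colliders, and $\frac{n(n-1)}{4}-\left\lfloor \frac{n-1}{2}\right\rfloor - \left\lfloor \frac{n}{4}\right\rfloor$ forks.
   Context: The transitive tournament $TT_n$ has vertex set $\{v_1,\dots,v_n\}$ and arc set $\{(v_i,v_j): 1\le i<j\le n\}$ (an arc $(u,v)$ is written $u\to v$). A chain is a digraph on three distinct vertices with arcs $a\to b\to c$; a collider is one with arcs $a\to b\leftarrow c$; a fork is one with arcs $a\leftarrow b\to c$. A chain--collider--fork decomposition of $TT_n$ is a partition of the arc set of $TT_n$ into two-element sets of arcs, each of which forms (as a subdigraph) a chain, a collider, or a fork. -}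

module Defs where

open import Data.Nat using (ℕ; zero; suc)
open import Data.Fin using (Fin; _<?_)
open import Data.List using (List; []; _∷_; concatMap; filter; allFin)
open import Data.Product using (_×_; _,_; proj₁; proj₂)
open import Data.Sum using (_⊎_)
open import Relation.Binary.PropositionalEquality using (_≡_; _≢_)
open import Relation.Binary.Core using (Rel)

Arc : ℕ → Set
Arc n = Fin n × Fin n

tail head : ∀ {n} → Arc n → Fin n
tail = proj₁
head = proj₂

arcsTT : (n : ℕ) → List (Arc n)
arcsTT n = concatMap (λ i → Data.List.map (λ j → (i , j)) (filter (i <?_) (allFin n))) (allFin n)
  where import Data.List

Distinct3 : ∀ {n} → Fin n → Fin n → Fin n → Set
Distinct3 a b c = (a ≢ b) × (b ≢ c) × (a ≢ c)

IsChain : ∀ {n} → Arc n → Arc n → Set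
IsChain e f =
    (head e ≡ tail f × Distinct3 (tail e) (head e) (head f))
  ⊎ (head f ≡ tail e × Distinct3 (tail f) (head f) (head e))

IsCollider : ∀ {n} → Arc n → Arc n → Set
IsCollider e f = head e ≡ head f × Distinct3 (tail e) (head e) (tail f)

IsFork : ∀ {n} → Arc n → Arc n → Set
IsFork e f = tail e ≡ tail f × Distinct3 (head e) (tail e) (head f)

data Kind : Set where
  chain collider fork : Kind

HasKind : ∀ {n} → Kind → Arc n → Arc n → Set
HasKind chain    e f = IsChain e f
HasKind collider e f = IsCollider e f
HasKind fork     e f = IsFork e f

record Block (n : ℕ) : Set where
  constructor block
  field
    kind : Kind
    arc₁ : Arc n
    arc₂ : Arc n
    ok   : HasKind kind arc₁ arc₂

open Block public

arcsOf : ∀ {n} → List (Block n) → List (Arc n)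
arcsOf []       = []
arcsOf (b ∷ bs) = arc₁ b ∷ arc₂ b ∷ arcsOf bs

count : ∀ {n} → Kind → List (Block n) → ℕ
count k []       = zero
count k (b ∷ bs) with kind b | k
... | chain    | chain    = suc (count k bs)
... | collider | collider = suc (count k bs)
... | fork     | fork     = suc (count k bs)
... | _        | _        = count k bs

{-# OPTIONS --safe #-}
-- Peel off the first four vertices a, b, c, d: the arcs of TT on a ∷ b ∷ c ∷ d ∷ ws are those of
-- TT on {a, b, c, d}, the four stars from a, b, c, d into ws, and those of TT on ws. When ws has
-- even size every star splits into forks, while the six arcs among a, b, c, d form the chains
-- a → b → c, a → c → d and the collider a → d ← b; so every four vertices add two chains and one
-- collider. The induction starts from TT₄ = fork + collider + chain when n ≡ 0 (mod 4), and from
-- TT₁ when n ≡ 1, where instead the tournament on five vertices a, …, d, v, sharing v with the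
-- rest, takes two chains, two forks and a collider. Forks need no bookkeeping: every block has
-- two arcs, so there are n(n − 1)/4 blocks in all.
module Submission where

open import Defs
open import Data.Nat using (ℕ; zero; suc; _+_; _*_; _∸_; _/_; _%_; _>_; _<_; s≤s; z≤n; NonZero)
open import Data.Nat.Properties using (*-assoc; *-distribʳ-+; +-suc; m+n∸m≡n; ∸-+-assoc; n>0⇒n≢0)
open import Data.Nat.DivMod using (m≡m%n+[m/n]*n; m*n/n≡m; m<n⇒m/n≡0; +-distrib-/-∣ʳ)
open import Data.Nat.Divisibility using (divides)
open import Data.Nat.Tactic.RingSolver using (solve-∀)
open import Data.Fin using (Fin; _<?_)
import Data.Fin as Fin
import Data.Fin.Properties as Fin
open import Data.List using (List; []; _∷_; _++_; [_]; map; length; filter; allFin; concatMap; tabulate)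
open import Data.List.Properties using (map-++; ++-assoc; ++-identityʳ; length-++; length-map; filter-all; filter-reject; concatMap-++)
open import Data.List.Relation.Unary.All using (All; []; _∷_)
import Data.List.Relation.Unary.All.Properties as All
open import Data.List.Relation.Unary.AllPairs using (AllPairs; []; _∷_)
open import Data.List.Relation.Unary.AllPairs.Properties using (tabulate⁺-<)
open import Data.List.Relation.Unary.Unique.Propositional using (Unique)
open import Data.List.Relation.Unary.Unique.Propositional.Properties using (allFin⁺)
open import Data.List.Relation.Binary.Permutation.Propositional
  using (_↭_; ↭-refl; ↭-sym; ↭-trans; ↭-reflexive; module PermutationReasoning)
open import Data.List.Relation.Binary.Permutation.Propositional.Properties
  using (++⁺; ++⁺ˡ; shifts; ↭-length; ++-commutativeMonoid)
import Algebra.Solver.CommutativeMonoid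
open import Data.Vec using (Vec; []; _∷_; toList)
import Data.Vec as Vec
open import Data.Vec.Properties using (length-toList)
open import Data.Product using (Σ; ∃-syntax; _×_; _,_)
open import Data.Sum using (_⊎_; inj₁; inj₂)
open import Relation.Nullary using (contradiction)
open import Relation.Binary.PropositionalEquality
  using (_≡_; _≢_; refl; sym; trans; cong; cong₂; ≢-sym; subst; module ≡-Reasoning)

tournament : {V : Set} → List V → List (V × V)
tournament []       = []
tournament (v ∷ vs) = map (v ,_) vs ++ tournament vs

arcsBetween : {V : Set} → List V → List V → List (V × V)
arcsBetween xs ys = concatMap (λ x → map (x ,_) ys) xs

tournament-++ : {V : Set} (xs ys : List V) →
  tournament (xs ++ ys) ↭ tournament xs ++ (arcsBetween xs ys ++ tournament ys)
tournament-++ []       ys = ↭-refl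
tournament-++ (x ∷ xs) ys = begin
  map (x ,_) (xs ++ ys) ++ tournament (xs ++ ys)  ≡⟨ cong (_++ tournament (xs ++ ys)) (map-++ (x ,_) xs ys) ⟩
  (X ++ Y) ++ tournament (xs ++ ys)               ↭⟨ ++⁺ˡ (X ++ Y) (tournament-++ xs ys) ⟩
  (X ++ Y) ++ (T ++ (B ++ U))                     ≡⟨ ++-assoc X Y _ ⟩
  X ++ (Y ++ (T ++ (B ++ U)))                     ↭⟨ ++⁺ˡ X (shifts Y T) ⟩
  X ++ (T ++ (Y ++ (B ++ U)))                     ≡⟨ sym (++-assoc X T _) ⟩
  (X ++ T) ++ (Y ++ (B ++ U))                     ≡⟨ cong ((X ++ T) ++_) (sym (++-assoc Y B U)) ⟩
  (X ++ T) ++ ((Y ++ B) ++ U)                     ∎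
  where
  open PermutationReasoning
  X = map (x ,_) xs
  Y = map (x ,_) ys
  T = tournament xs
  B = arcsBetween xs ys
  U = tournament ys

tournament-++-shared : {V : Set} (xs : List V) (v : V) (ys : List V) →
  tournament (xs ++ v ∷ ys) ↭ tournament (xs ++ [ v ]) ++ (arcsBetween xs ys ++ tournament (v ∷ ys))
tournament-++-shared xs v ys = begin
  tournament (xs ++ v ∷ ys)                             ≡⟨ cong tournament (sym (++-assoc xs [ v ] ys)) ⟩
  tournament ((xs ++ [ v ]) ++ ys)                      ↭⟨ tournament-++ (xs ++ [ v ]) ys ⟩
  T ++ (arcsBetween (xs ++ [ v ]) ys ++ tournament ys)  ≡⟨ cong (λ A → T ++ (A ++ tournament ys)) arcsBetween-∷ʳ ⟩
  T ++ ((B ++ map (v ,_) ys) ++ tournament ys)          ≡⟨ cong (T ++_) (++-assoc B (map (v ,_) ys) (tournament ys)) ⟩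
  T ++ (B ++ tournament (v ∷ ys))                       ∎
  where
  open PermutationReasoning
  T = tournament (xs ++ [ v ])
  B = arcsBetween xs ys
  arcsBetween-∷ʳ : arcsBetween (xs ++ [ v ]) ys ≡ B ++ map (v ,_) ys
  arcsBetween-∷ʳ = trans (concatMap-++ _ xs [ v ]) (cong (B ++_) (++-identityʳ (map (v ,_) ys)))

length-tournament : {V : Set} (xs : List V) → length (tournament xs) * 2 ≡ length xs * (length xs ∸ 1)
length-tournament []       = refl
length-tournament (x ∷ xs) = begin
  length (map (x ,_) xs ++ tournament xs) * 2  ≡⟨ cong (_* 2) (length-++ (map (x ,_) xs)) ⟩
  (length (map (x ,_) xs) + length (tournament xs)) * 2
                                               ≡⟨ cong (λ m → (m + length (tournament xs)) * 2) (length-map (x ,_) xs) ⟩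
  (length xs + length (tournament xs)) * 2     ≡⟨ *-distribʳ-+ 2 (length xs) _ ⟩
  length xs * 2 + length (tournament xs) * 2   ≡⟨ cong (length xs * 2 +_) (length-tournament xs) ⟩
  length xs * 2 + length xs * (length xs ∸ 1)  ≡⟨ add-vertex (length xs) ⟩
  suc (length xs) * length xs                  ∎
  where
  open ≡-Reasoning
  add-vertex : ∀ m → m * 2 + m * (m ∸ 1) ≡ suc m * m
  add-vertex zero    = refl
  add-vertex (suc m) = identity m
    where
    identity : ∀ m → suc m * 2 + suc m * m ≡ suc (suc m) * suc m
    identity = solve-∀

outArcs : ∀ {n} → List (Fin n) → Fin n → List (Arc n)
outArcs xs i = map (i ,_) (filter (i <?_) xs)

outArcs-∷-above : ∀ {n} {x : Fin n} {ys} zs → All (x Fin.<_) zs →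
  concatMap (outArcs (x ∷ ys)) zs ≡ concatMap (outArcs ys) zs
outArcs-∷-above []       []           = refl
outArcs-∷-above (z ∷ zs) (x<z ∷ x<zs) =
  cong₂ _++_ (cong (map (z ,_)) (filter-reject (z <?_) (Fin.<-asym x<z))) (outArcs-∷-above zs x<zs)

outArcs-sorted : ∀ {n} {xs : List (Fin n)} → AllPairs Fin._<_ xs → concatMap (outArcs xs) xs ≡ tournament xs
outArcs-sorted {xs = []}     []             = refl
outArcs-sorted {xs = x ∷ ys} (x<ys ∷ sorted) = cong₂ _++_
  (cong (map (x ,_)) (trans (filter-reject (x <?_) (Fin.<-irrefl refl)) (filter-all (x <?_) x<ys)))
  (trans (outArcs-∷-above ys x<ys) (outArcs-sorted sorted))

arcsTT-tournament : ∀ n → arcsTT n ≡ tournament (allFin n)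
arcsTT-tournament n = outArcs-sorted (tabulate⁺-< (λ i<j → i<j))

toList-tabulate : ∀ {A : Set} {n} (f : Fin n → A) → toList (Vec.tabulate f) ≡ tabulate f
toList-tabulate {n = zero}  f = refl
toList-tabulate {n = suc n} f = cong (f Fin.zero ∷_) (toList-tabulate (λ i → f (Fin.suc i)))

allPairs-++⁻ : {A : Set} {R : A → A → Set} (xs : List A) {ys : List A} → AllPairs R (xs ++ ys) →
  AllPairs R xs × All (λ x → All (R x) ys) xs × AllPairs R ys
allPairs-++⁻ []       rs        = [] , [] , rs
allPairs-++⁻ (x ∷ xs) (rx ∷ rs) with allPairs-++⁻ xs rs
... | rxs , rxs-ys , rys = All.++⁻ˡ xs rx ∷ rxs , All.++⁻ʳ xs rx ∷ rxs-ys , rys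

module _ {n : ℕ} where

  chainBlock forkBlock colliderBlock : (a b c : Fin n) → Distinct3 a b c → Block n
  chainBlock    a b c distinct          = block chain (a , b) (b , c) (inj₁ (refl , distinct))
  forkBlock     a b c (a≢b , b≢c , a≢c) = block fork (a , b) (a , c) (refl , ≢-sym a≢b , a≢c , b≢c)
  colliderBlock a b c (a≢b , b≢c , a≢c) = block collider (a , c) (b , c) (refl , a≢c , ≢-sym b≢c , a≢b)

  arcsOf-++ : (bs cs : List (Block n)) → arcsOf (bs ++ cs) ≡ arcsOf bs ++ arcsOf cs
  arcsOf-++ []       cs = refl
  arcsOf-++ (b ∷ bs) cs = cong (λ A → arc₁ b ∷ arc₂ b ∷ A) (arcsOf-++ bs cs)

  length-arcsOf : (bs : List (Block n)) → length (arcsOf bs) ≡ length bs * 2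
  length-arcsOf []       = refl
  length-arcsOf (b ∷ bs) = cong (λ m → suc (suc m)) (length-arcsOf bs)

  count-++ : ∀ k (bs cs : List (Block n)) → count k (bs ++ cs) ≡ count k bs + count k cs
  count-++ k        []                          cs = refl
  count-++ chain    (block chain    _ _ _ ∷ bs) cs = cong suc (count-++ chain bs cs)
  count-++ chain    (block collider _ _ _ ∷ bs) cs = count-++ chain bs cs
  count-++ chain    (block fork     _ _ _ ∷ bs) cs = count-++ chain bs cs
  count-++ collider (block chain    _ _ _ ∷ bs) cs = count-++ collider bs cs
  count-++ collider (block collider _ _ _ ∷ bs) cs = cong suc (count-++ collider bs cs)
  count-++ collider (block fork     _ _ _ ∷ bs) cs = count-++ collider bs cs
  count-++ fork     (block chain    _ _ _ ∷ bs) cs = count-++ fork bs cs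
  count-++ fork     (block collider _ _ _ ∷ bs) cs = count-++ fork bs cs
  count-++ fork     (block fork     _ _ _ ∷ bs) cs = cong suc (count-++ fork bs cs)

  count-kinds : (bs : List (Block n)) → count chain bs + count collider bs + count fork bs ≡ length bs
  count-kinds []                          = refl
  count-kinds (block chain    _ _ _ ∷ bs) = cong suc (count-kinds bs)
  count-kinds (block collider _ _ _ ∷ bs) =
    trans (cong (_+ count fork bs) (+-suc (count chain bs) _)) (cong suc (count-kinds bs))
  count-kinds (block fork     _ _ _ ∷ bs) = trans (+-suc _ (count fork bs)) (cong suc (count-kinds bs))

  -- No fork count: it is forced by the number of arcs (forks-determined).
  record Decomposition (A : List (Arc n)) (c l : ℕ) : Set where
    field
      blocks    : List (Block n)
      covers    : arcsOf blocks ↭ A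
      chains    : count chain blocks ≡ c
      colliders : count collider blocks ≡ l

  open Decomposition

  fromBlocks : (bs : List (Block n)) → Decomposition (arcsOf bs) (count chain bs) (count collider bs)
  fromBlocks bs = record { blocks = bs ; covers = ↭-refl ; chains = refl ; colliders = refl }

  infixr 5 _⊕_

  _⊕_ : ∀ {A B c c′ l l′} → Decomposition A c l → Decomposition B c′ l′ → Decomposition (A ++ B) (c + c′) (l + l′)
  D ⊕ E = record
    { blocks    = blocks D ++ blocks E
    ; covers    = ↭-trans (↭-reflexive (arcsOf-++ (blocks D) (blocks E))) (++⁺ (covers D) (covers E))
    ; chains    = trans (count-++ chain (blocks D) (blocks E)) (cong₂ _+_ (chains D) (chains E))
    ; colliders = trans (count-++ collider (blocks D) (blocks E)) (cong₂ _+_ (colliders D) (colliders E))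
    }

  reorder : ∀ {A B c l} → A ↭ B → Decomposition A c l → Decomposition B c l
  reorder A↭B D = record
    { blocks = blocks D ; covers = ↭-trans (covers D) A↭B ; chains = chains D ; colliders = colliders D }

  recount : ∀ {A c c′ l l′} → c ≡ c′ → l ≡ l′ → Decomposition A c l → Decomposition A c′ l′
  recount refl refl D = D

  forks-determined : ∀ {m} (vs : Vec (Fin n) m) (bs : List (Block n)) → arcsOf bs ↭ tournament (toList vs) →
    count fork bs ≡ m * (m ∸ 1) / 4 ∸ count chain bs ∸ count collider bs
  forks-determined {m} vs bs covers = begin
    count fork bs                    ≡⟨ sym (m+n∸m≡n (c + l) (count fork bs)) ⟩
    c + l + count fork bs ∸ (c + l)  ≡⟨ cong (_∸ (c + l)) (count-kinds bs) ⟩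
    length bs ∸ (c + l)              ≡⟨ sym (∸-+-assoc (length bs) c l) ⟩
    length bs ∸ c ∸ l                ≡⟨ cong (λ b → b ∸ c ∸ l) number-of-blocks ⟨
    m * (m ∸ 1) / 4 ∸ c ∸ l          ∎
    where
    open ≡-Reasoning
    c = count chain bs
    l = count collider bs
    arcs : length bs * 4 ≡ m * (m ∸ 1)
    arcs = begin
      length bs * 4                                  ≡⟨ *-assoc (length bs) 2 2 ⟨
      length bs * 2 * 2                              ≡⟨ cong (_* 2) (length-arcsOf bs) ⟨
      length (arcsOf bs) * 2                         ≡⟨ cong (_* 2) (↭-length covers) ⟩
      length (tournament (toList vs)) * 2            ≡⟨ length-tournament (toList vs) ⟩
      length (toList vs) * (length (toList vs) ∸ 1)  ≡⟨ cong (λ k → k * (k ∸ 1)) (length-toList vs) ⟩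
      m * (m ∸ 1)                                    ∎
    number-of-blocks : m * (m ∸ 1) / 4 ≡ length bs
    number-of-blocks = trans (cong (_/ 4) (sym arcs)) (m*n/n≡m (length bs) 4)

  star-forks : ∀ K (v : Fin n) (ws : Vec (Fin n) (K * 2)) → All (v ≢_) (toList ws) → Unique (toList ws) →
    Decomposition (map (v ,_) (toList ws)) 0 0
  star-forks zero    v []           _                  _                        = fromBlocks []
  star-forks (suc K) v (w ∷ w′ ∷ ws) (v≢w ∷ v≢w′ ∷ v∉ws) ((w≢w′ ∷ _) ∷ _ ∷ u-ws) =
    fromBlocks (forkBlock v w w′ (v≢w , w≢w′ , v≢w′) ∷ []) ⊕ star-forks K v ws v∉ws u-ws

  arcsBetween-forks : ∀ K {xs} (ws : Vec (Fin n) (K * 2)) → All (λ x → All (x ≢_) (toList ws)) xs →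
    Unique (toList ws) → Decomposition (arcsBetween xs (toList ws)) 0 0
  arcsBetween-forks K ws []              u-ws = fromBlocks []
  arcsBetween-forks K ws (x∉ws ∷ xs∉ws) u-ws = star-forks K _ ws x∉ws u-ws ⊕ arcsBetween-forks K ws xs∉ws u-ws

  module ArcBag = Algebra.Solver.CommutativeMonoid (++-commutativeMonoid {A = Arc n})

  tournament₄-one-of-each : ∀ {a b c d} → Unique (a ∷ b ∷ c ∷ d ∷ []) →
    Decomposition (tournament (a ∷ b ∷ c ∷ d ∷ [])) 1 1
  tournament₄-one-of-each {a} {b} {c} {d} ((a≢b ∷ a≢c ∷ a≢d ∷ []) ∷ (b≢c ∷ b≢d ∷ []) ∷ (c≢d ∷ []) ∷ [] ∷ []) =
    reorder (solve 6 (λ ab ac ad bc bd cd → ab ∙ ac ∙ ad ∙ bd ∙ bc ∙ cd ⊜ ab ∙ ac ∙ ad ∙ bc ∙ bd ∙ cd) ↭-refl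
               [ a , b ] [ a , c ] [ a , d ] [ b , c ] [ b , d ] [ c , d ])
      (fromBlocks ( forkBlock a b c (a≢b , b≢c , a≢c)
                  ∷ colliderBlock a b d (a≢b , b≢d , a≢d)
                  ∷ chainBlock b c d (b≢c , c≢d , b≢d)
                  ∷ []))
    where open ArcBag using (solve; _⊜_) renaming (_⊕_ to _∙_)


  tournament₄-two-chains : ∀ {a b c d} → Unique (a ∷ b ∷ c ∷ d ∷ []) →
    Decomposition (tournament (a ∷ b ∷ c ∷ d ∷ [])) 2 1
  tournament₄-two-chains {a} {b} {c} {d} ((a≢b ∷ a≢c ∷ a≢d ∷ []) ∷ (b≢c ∷ b≢d ∷ []) ∷ (c≢d ∷ []) ∷ [] ∷ []) =
    reorder (solve 6 (λ ab ac ad bc bd cd → ab ∙ bc ∙ ac ∙ cd ∙ ad ∙ bd ⊜ ab ∙ ac ∙ ad ∙ bc ∙ bd ∙ cd) ↭-refl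
               [ a , b ] [ a , c ] [ a , d ] [ b , c ] [ b , d ] [ c , d ])
      (fromBlocks ( chainBlock a b c (a≢b , b≢c , a≢c)
                  ∷ chainBlock a c d (a≢c , c≢d , a≢d)
                  ∷ colliderBlock a b d (a≢b , b≢d , a≢d)
                  ∷ []))
    where open ArcBag using (solve; _⊜_) renaming (_⊕_ to _∙_)

  tournament₅-two-chains : ∀ {a b c d e} → Unique (a ∷ b ∷ c ∷ d ∷ e ∷ []) →
    Decomposition (tournament (a ∷ b ∷ c ∷ d ∷ e ∷ [])) 2 1
  tournament₅-two-chains {a} {b} {c} {d} {e}
    ((a≢b ∷ a≢c ∷ a≢d ∷ a≢e ∷ []) ∷ (b≢c ∷ b≢d ∷ b≢e ∷ []) ∷ (c≢d ∷ c≢e ∷ []) ∷ (d≢e ∷ []) ∷ [] ∷ []) =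
    reorder (solve 10 (λ ab ac ad ae bc bd be cd ce de →
                         ab ∙ bc ∙ ac ∙ cd ∙ ad ∙ ae ∙ bd ∙ be ∙ ce ∙ de
                       ⊜ ab ∙ ac ∙ ad ∙ ae ∙ bc ∙ bd ∙ be ∙ cd ∙ ce ∙ de) ↭-refl
               [ a , b ] [ a , c ] [ a , d ] [ a , e ] [ b , c ] [ b , d ] [ b , e ] [ c , d ] [ c , e ] [ d , e ])
      (fromBlocks ( chainBlock a b c (a≢b , b≢c , a≢c)
                  ∷ chainBlock a c d (a≢c , c≢d , a≢d)
                  ∷ forkBlock a d e (a≢d , d≢e , a≢e)
                  ∷ forkBlock b d e (b≢d , d≢e , b≢e)
                  ∷ colliderBlock c d e (c≢d , d≢e , c≢e)
                  ∷ []))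
    where open ArcBag using (solve; _⊜_) renaming (_⊕_ to _∙_)

  -- Sizes are written k * 2 * 2 rather than k * 4 so that peeling off four vertices, and pairing
  -- the remaining ones into forks, are plain pattern matches on Vec.
  even-decomposition : ∀ k (vs : Vec (Fin n) (suc k * 2 * 2)) → Unique (toList vs) →
    Decomposition (tournament (toList vs)) (1 + k * 2) (suc k)
  even-decomposition zero    (a ∷ b ∷ c ∷ d ∷ [])  u = tournament₄-one-of-each u
  even-decomposition (suc k) (a ∷ b ∷ c ∷ d ∷ ws) u with allPairs-++⁻ (a ∷ b ∷ c ∷ d ∷ []) u
  ... | u-abcd , abcd∉ws , u-ws =
    reorder (↭-sym (tournament-++ (a ∷ b ∷ c ∷ d ∷ []) (toList ws)))
      (tournament₄-two-chains u-abcd ⊕ arcsBetween-forks (suc k * 2) ws abcd∉ws u-ws ⊕ even-decomposition k ws u-ws)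

  odd-decomposition : ∀ k (vs : Vec (Fin n) (suc (k * 2 * 2))) → Unique (toList vs) →
    Decomposition (tournament (toList vs)) (k * 2) k
  odd-decomposition zero    (v ∷ [])                 u = fromBlocks []
  odd-decomposition (suc k) (a ∷ b ∷ c ∷ d ∷ v ∷ ws) u with allPairs-++⁻ (a ∷ b ∷ c ∷ d ∷ v ∷ []) u
  ... | u-abcdv , (a∉ws ∷ b∉ws ∷ c∉ws ∷ d∉ws ∷ v∉ws ∷ []) , u-ws =
    reorder (↭-sym (tournament-++-shared (a ∷ b ∷ c ∷ d ∷ []) v (toList ws)))
      (tournament₅-two-chains u-abcdv
        ⊕ arcsBetween-forks (k * 2) ws (a∉ws ∷ b∉ws ∷ c∉ws ∷ d∉ws ∷ []) u-ws
        ⊕ odd-decomposition k (v ∷ ws) (v∉ws ∷ u-ws))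

[m+kn]/n≡k : ∀ {m} k n .{{_ : NonZero n}} → m < n → (m + k * n) / n ≡ k
[m+kn]/n≡k {m} k n m<n = begin
  (m + k * n) / n    ≡⟨ +-distrib-/-∣ʳ m (divides k refl) ⟩
  m / n + k * n / n  ≡⟨ cong₂ _+_ (m<n⇒m/n≡0 m<n) (m*n/n≡m k n) ⟩
  k                  ∎
  where open ≡-Reasoning

mod4-cases : ∀ m → m > 0 → m % 4 ≡ 0 ⊎ m % 4 ≡ 1 → (∃[ k ] m ≡ suc k * 2 * 2) ⊎ (∃[ k ] m ≡ suc (k * 2 * 2))
mod4-cases m m>0 (inj₁ m%4≡0) with m / 4 | m≡m%n+[m/n]*n m 4
... | zero  | m≡ = contradiction (trans m≡ (cong (_+ 0) m%4≡0)) (n>0⇒n≢0 m>0)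
... | suc k | m≡ = inj₁ (k , trans m≡ (trans (cong (_+ suc k * 4) m%4≡0) (sym (*-assoc (suc k) 2 2))))
mod4-cases m m>0 (inj₂ m%4≡1) = inj₂ (m / 4 , trans (m≡m%n+[m/n]*n m 4) (cong₂ _+_ m%4≡1 (sym (*-assoc (m / 4) 2 2))))

tournament-decomposition : ∀ {n m} (vs : Vec (Fin n) m) → Unique (toList vs) → m > 0 → m % 4 ≡ 0 ⊎ m % 4 ≡ 1 →
  Decomposition (tournament (toList vs)) ((m ∸ 1) / 2) (m / 4)
tournament-decomposition vs u m>0 r with mod4-cases _ m>0 r
... | inj₁ (k , refl) = recount (sym ([m+kn]/n≡k {1} (suc (k * 2)) 2 (s≤s (s≤s z≤n))))
  (sym (trans (cong (_/ 4) (*-assoc (suc k) 2 2)) (m*n/n≡m (suc k) 4))) (even-decomposition k vs u)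
... | inj₂ (k , refl) = recount (sym (m*n/n≡m (k * 2) 2))
  (sym (trans (cong (λ x → suc x / 4) (*-assoc k 2 2)) ([m+kn]/n≡k {1} k 4 (s≤s (s≤s z≤n))))) (odd-decomposition k vs u)

mainTheorem2 : (n : ℕ) → n > 0 → (n % 4 ≡ 0 ⊎ n % 4 ≡ 1) →
    Σ (List (Block n)) λ D →
        (arcsOf D ↭ arcsTT n)
      × (count chain D ≡ (n ∸ 1) / 2)
      × (count collider D ≡ n / 4)
      × (count fork D ≡ (n * (n ∸ 1)) / 4 ∸ (n ∸ 1) / 2 ∸ n / 4)
mainTheorem2 n n>0 r = blocks , ↭-trans covers (↭-reflexive vertices-arcsTT) , chains , colliders , forks
  where
  vertices : toList (Vec.allFin n) ≡ allFin n
  vertices = toList-tabulate (λ i → i)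
  vertices-arcsTT : tournament (toList (Vec.allFin n)) ≡ arcsTT n
  vertices-arcsTT = trans (cong tournament vertices) (sym (arcsTT-tournament n))
  open Decomposition (tournament-decomposition (Vec.allFin n) (subst Unique (sym vertices) (allFin⁺ n)) n>0 r)
  forks : count fork blocks ≡ n * (n ∸ 1) / 4 ∸ (n ∸ 1) / 2 ∸ n / 4
  forks = trans (forks-determined (Vec.allFin n) blocks covers) (cong₂ (λ c l → n * (n ∸ 1) / 4 ∸ c ∸ l) chains colliders)
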